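{- Fix $k\ge2$ and write $A_xy=A_x(k,y)$. Suppose $m\equiv_k A_ab$ with $a>0$ and let $(c_i)_{i\le a}$ be the left expansion sequence for $A_ab$. Then for every $i\le a$, $m\ge k\,c_i$, with equality holding if and only if $i=a$.
   Context: Ackermann function: for $k\ge 2$, $a,b\ge 0$: $A_a(k,-1):=1$, $A_0(k,b):=k^b$, $A_{a+1}(k,b):=A_a(k,\cdot)^k(A_{a+1}(k,b-1))$; $A_x^jy$ denotes the $j$-fold iterate of $y\mapsto A_xy$. $k$-normal form: for $m>0$, $m\equiv_k A_ab+c$ means $m=A_ab+c$ and there exist $n\ge1$ and naturals $a_1..a_n$, $b_1..b_n$, $m_0..m_n$ with $m_0=0$; for $0\le i<n$: $A_{a_{i+1}}m_i\le m<A_{a_{i+1}+1}m_i$, $A_{a_{i+1}}b_{i+1}\le m<A_{a_{i+1}}(b_{i+1}+1)$, $m_{i+1}=A_{a_{i+1}}b_{i+1}$; $A_0m_n>m$; $a=a_n$, $b=b_n$. $m\equiv_k A_ab$ means $m\equiv_k A_ab+0$. Left expansion sequence: for $A_ab$ in normal form with $a>0$, define $c_0=A_a(b-1)$ (using $A_a(-1)=1$ if $b=0$) and $c_i=A_{a-i}\big(A_{a-i}^{k-1}c_{i-1}-1\big)$ for $1\le i\le a$. -}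

module Defs where

open import Data.Nat using (ℕ; zero; suc; _+_; _*_; _∸_; _^_; _≤_; _<_)
open import Data.Product using (Σ; _×_)
open import Relation.Binary.PropositionalEquality using (_≡_)

iter : (ℕ → ℕ) → ℕ → ℕ → ℕ
iter f zero    y = y
iter f (suc j) y = f (iter f j y)

-- Shifted Ackermann: A' a k n = A_a(k, n - 1), so that A' a k 0 = A_a(k,-1) = 1.
A' : ℕ → ℕ → ℕ → ℕ
A' a       k zero    = 1
A' zero    k (suc b) = k ^ b
A' (suc a) k (suc b) = iter (λ y → A' a k (suc y)) k (A' (suc a) k b)

Ack : ℕ → ℕ → ℕ → ℕ
Ack k a b = A' a k (suc b)

AckPred : ℕ → ℕ → ℕ → ℕ
AckPred k a b = A' a k b

-- k-normal form:  m ≡_k A_a b + c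
NormalForm : (k m a b c : ℕ) → Set
NormalForm k m a b c =
  0 < m × m ≡ Ack k a b + c ×
  Σ ℕ λ n → Σ (ℕ → ℕ) λ as → Σ (ℕ → ℕ) λ bs → Σ (ℕ → ℕ) λ ms →
    1 ≤ n × ms 0 ≡ 0 ×
    (∀ i → i < n →
        (Ack k (as (suc i)) (ms i) ≤ m × m < Ack k (suc (as (suc i))) (ms i))
      × (Ack k (as (suc i)) (bs (suc i)) ≤ m × m < Ack k (as (suc i)) (suc (bs (suc i))))
      × ms (suc i) ≡ Ack k (as (suc i)) (bs (suc i)))
    × m < Ack k 0 (ms n)
    × a ≡ as n × b ≡ bs n

-- Left expansion sequence for A_a b:
--   c_0 = A_a(b-1),  c_i = A_{a-i}(A_{a-i}^{k-1} c_{i-1} - 1)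
-- (the inner argument is always ≥ 1 since all Ackermann values are ≥ 1,
--  so truncated subtraction agrees with ordinary subtraction)
leftExp : (k a b : ℕ) → ℕ → ℕ
leftExp k a b zero    = AckPred k a b
leftExp k a b (suc i) =
  Ack k (a ∸ suc i) (iter (Ack k (a ∸ suc i)) (k ∸ 1) (leftExp k a b i) ∸ 1)

-- Peeling one Ackermann level at a time: writing x = a - i - 1, one has
-- m = A_a b = A_x^k c_i for every i < a, because A_{x+1}^k c = A_{x+1}(d) with
-- d = A_{x+1}^{k-1} c ≥ 1, and A_{x+1}(d) = A_x^k (A_{x+1}(d - 1)) unfolds the
-- next level.  Since A_x y ≥ k^y > y, the k-fold iterate A_x^k c exceeds k c,
-- giving m > k c_i for i < a; at the last level A_0^k c = k^d = k · A_0(d - 1),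
-- so m = k c_a.
module Submission where

open import Defs
open import Data.Nat using (ℕ; zero; suc; _*_; _∸_; _^_; _≤_; _<_; z≤n; z<s; NonZero; >-nonZero)
open import Data.Nat.Properties
open import Data.Product using (_×_; _,_)
open import Data.Sum using (inj₁; inj₂)
open import Function using (_∘_)
open import Relation.Nullary using (contradiction)
open import Relation.Binary.PropositionalEquality

module _ {f : ℕ → ℕ} where

  iter-pred : ∀ {j} → 0 < j → ∀ z → iter f j z ≡ f (iter f (j ∸ 1) z)
  iter-pred {suc j} _ z = refl

  iter-extensive : (∀ z → z ≤ f z) → ∀ j z → z ≤ iter f j z
  iter-extensive f≥ zero    z = ≤-refl
  iter-extensive f≥ (suc j) z = ≤-trans (iter-extensive f≥ j z) (f≥ _)

  iter-strictlyExtensive : (∀ z → z < f z) → ∀ {j} → 0 < j → ∀ z → z < iter f j z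
  iter-strictlyExtensive f> {suc j} _ z =
    ≤-<-trans (iter-extensive (<⇒≤ ∘ f>) j z) (f> _)

Ack[d∸1]≡AckPred[d] : ∀ {k x d} → 0 < d → Ack k x (d ∸ 1) ≡ AckPred k x d
Ack[d∸1]≡AckPred[d] {d = suc d} _ = refl

k*Ack₀[d∸1]≡Ack₀[d] : ∀ {k d} → 0 < d → k * Ack k 0 (d ∸ 1) ≡ Ack k 0 d
k*Ack₀[d∸1]≡Ack₀[d] {d = suc d} _ = refl

module _ {k : ℕ} (1<k : 1 < k) where

  private
    0<k : 0 < k
    0<k = <-trans z<s 1<k

    instance
      k-nonZero : NonZero k
      k-nonZero = >-nonZero 0<k

    0<k∸1 : 0 < k ∸ 1
    0<k∸1 = m<n⇒0<n∸m 1<k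

  n<k^n : ∀ n → n < k ^ n
  n<k^n zero    = z<s
  n<k^n (suc n) = ≤-<-trans (n<k^n n) (^-monoʳ-< k 1<k (n<1+n n))

  mutual
    k^y≤Ack : ∀ x y → k ^ y ≤ Ack k x y
    k^y≤Ack zero    y = ≤-refl
    k^y≤Ack (suc x) y = begin
      k ^ y                               ≤⟨ ^-monoʳ-≤ k (y≤AckPred (suc x) y) ⟩
      k ^ w                               ≤⟨ ^-monoʳ-≤ k (iter-extensive (<⇒≤ ∘ y<Ack x) (k ∸ 1) w) ⟩
      k ^ iter (Ack k x) (k ∸ 1) w        ≤⟨ k^y≤Ack x _ ⟩
      Ack k x (iter (Ack k x) (k ∸ 1) w)  ≡⟨ iter-pred 0<k w ⟨
      Ack k (suc x) y                     ∎
      where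
        open ≤-Reasoning
        w : ℕ
        w = AckPred k (suc x) y

    y<Ack : ∀ x y → y < Ack k x y
    y<Ack x y = <-≤-trans (n<k^n y) (k^y≤Ack x y)

    y≤AckPred : ∀ x y → y ≤ AckPred k x y
    y≤AckPred x zero    = z≤n
    y≤AckPred x (suc y) = y<Ack x y

  k*c<iter-Ack : ∀ x c → k * c < iter (Ack k x) k c
  k*c<iter-Ack x c = begin-strict
    k * c                               <⟨ *-monoʳ-< k (n<k^n c) ⟩
    k ^ suc c                           ≤⟨ ^-monoʳ-≤ k (iter-strictlyExtensive (y<Ack x) 0<k∸1 c) ⟩
    k ^ iter (Ack k x) (k ∸ 1) c        ≤⟨ k^y≤Ack x _ ⟩
    Ack k x (iter (Ack k x) (k ∸ 1) c)  ≡⟨ iter-pred 0<k c ⟨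
    iter (Ack k x) k c                  ∎
    where open ≤-Reasoning

  private
    0<iter-Ack : ∀ x c → 0 < iter (Ack k x) (k ∸ 1) c
    0<iter-Ack x c = m<n⇒0<n (iter-strictlyExtensive (y<Ack x) 0<k∸1 c)

  iter-Ack-suc : ∀ x c →
    iter (Ack k (suc x)) k c ≡
    iter (Ack k x) k (Ack k (suc x) (iter (Ack k (suc x)) (k ∸ 1) c ∸ 1))
  iter-Ack-suc x c = begin
    iter (Ack k (suc x)) k c                ≡⟨ iter-pred 0<k c ⟩
    iter (Ack k x) k (AckPred k (suc x) d)  ≡⟨ cong (iter (Ack k x) k) (Ack[d∸1]≡AckPred[d] (0<iter-Ack (suc x) c)) ⟨
    iter (Ack k x) k (Ack k (suc x) (d ∸ 1)) ∎
    where
      open ≡-Reasoning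
      d : ℕ
      d = iter (Ack k (suc x)) (k ∸ 1) c

  iter-Ack-zero : ∀ c →
    iter (Ack k 0) k c ≡ k * Ack k 0 (iter (Ack k 0) (k ∸ 1) c ∸ 1)
  iter-Ack-zero c = trans (iter-pred 0<k c) (sym (k*Ack₀[d∸1]≡Ack₀[d] (0<iter-Ack 0 c)))

  Ack≡iter-leftExp : ∀ {a} b i → i < a →
    Ack k a b ≡ iter (Ack k (a ∸ suc i)) k (leftExp k a b i)
  Ack≡iter-leftExp {suc a} b zero    _   = refl
  Ack≡iter-leftExp {a}     b (suc i) i<a = begin
    Ack k a b                     ≡⟨ Ack≡iter-leftExp b i (<-trans (n<1+n i) i<a) ⟩
    iter (Ack k (a ∸ suc i)) k c  ≡⟨ unfold-level (+-∸-assoc 1 i<a) ⟩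
    iter (Ack k x) k (leftExp k a b (suc i)) ∎
    where
      open ≡-Reasoning
      c x : ℕ
      c = leftExp k a b i
      x = a ∸ suc (suc i)
      unfold-level : ∀ {y} → y ≡ suc x →
        iter (Ack k y) k c ≡ iter (Ack k x) k (Ack k y (iter (Ack k y) (k ∸ 1) c ∸ 1))
      unfold-level refl = iter-Ack-suc x c

  k*leftExp<Ack : ∀ {a} b {i} → i < a → k * leftExp k a b i < Ack k a b
  k*leftExp<Ack {a} b {i} i<a =
    <-≤-trans (k*c<iter-Ack (a ∸ suc i) (leftExp k a b i))
              (≤-reflexive (sym (Ack≡iter-leftExp b i i<a)))

  k*leftExp-last≡Ack : ∀ {a} b → 0 < a → k * leftExp k a b a ≡ Ack k a b
  k*leftExp-last≡Ack {suc a} b _ =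
    trans (bottom-level (n∸n≡0 a)) (sym (Ack≡iter-leftExp b a ≤-refl))
    where
      c : ℕ
      c = leftExp k (suc a) b a
      bottom-level : ∀ {y} → y ≡ 0 →
        k * Ack k y (iter (Ack k y) (k ∸ 1) c ∸ 1) ≡ iter (Ack k y) k c
      bottom-level refl = sym (iter-Ack-zero c)

corollary4p4 : (k m a b : ℕ) → 2 ≤ k → NormalForm k m a b 0 → 0 < a →
    (i : ℕ) → i ≤ a →
      (k * leftExp k a b i ≤ m)
      × (k * leftExp k a b i ≡ m → i ≡ a)
      × (i ≡ a → k * leftExp k a b i ≡ m)
corollary4p4 k m a b 1<k (_ , m≡Ack+0 , _) 0<a i i≤a
  rewrite m≡Ack+0 | +-identityʳ (Ack k a b) with m≤n⇒m<n∨m≡n i≤a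
... | inj₁ i<a =
  <⇒≤ k*c<m , (λ k*c≡m → contradiction k*c≡m (<⇒≢ k*c<m)) , (λ i≡a → contradiction i≡a (<⇒≢ i<a))
  where
    k*c<m : k * leftExp k a b i < Ack k a b
    k*c<m = k*leftExp<Ack 1<k b i<a
... | inj₂ refl = ≤-reflexive k*c≡m , (λ _ → refl) , (λ _ → k*c≡m)
  where
    k*c≡m : k * leftExp k a b a ≡ Ack k a b
    k*c≡m = k*leftExp-last≡Ack 1<k b 0<a
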